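{- Let $S$ be a group. Then the class $\mathfrak{R}$ of all regular $S$-polygons is axiomatizable.
   Context: For a monoid $S$, a (left) $S$-polygon is a set $A$ with an action $S\times A\to A$ satisfying $s_1(s_2a)=(s_1s_2)a$ and $1a=a$, regarded as a structure in the language $L_S=\{s\mid s\in S\}$ of unary function symbols. For $a\in A$, $Sa=\{sa\mid s\in S\}$. An element $a\in A$ is act-regular if there is a polygon homomorphism $\varphi:Sa\to S$ (with $S$ acting on itself by left multiplication) with $\varphi(a)a=a$; $A$ is regular if all its elements are act-regular. A class of $L_S$-structures is axiomatizable if it is exactly the class of models of some set of first-order $L_S$-sentences. -}

module Defs where

open import Data.Nat using (ℕ; zero; suc)
open import Data.Fin using (Fin)
open import Data.Product using (Σ; _×_; _,_; proj₁)
open import Data.Sum using (_⊎_)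
open import Data.Empty using (⊥)
open import Relation.Binary.PropositionalEquality using (_≡_)
open import Level using (0ℓ)

-- First-order language L_S = { s | s ∈ S } of unary function symbols
-- (with equality), variables as de Bruijn indices Fin n.

data Term (S : Set) (n : ℕ) : Set where
  var : Fin n → Term S n
  app : S → Term S n → Term S n

data Formula (S : Set) : ℕ → Set where
  _≐_  : ∀ {n} → Term S n → Term S n → Formula S n
  ⊥'   : ∀ {n} → Formula S n
  ¬'_  : ∀ {n} → Formula S n → Formula S n
  _∧'_ : ∀ {n} → Formula S n → Formula S n → Formula S n
  _∨'_ : ∀ {n} → Formula S n → Formula S n → Formula S n
  _⇒'_ : ∀ {n} → Formula S n → Formula S n → Formula S n
  ∀'_  : ∀ {n} → Formula S (suc n) → Formula S n
  ∃'_  : ∀ {n} → Formula S (suc n) → Formula S n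

Sentence : Set → Set
Sentence S = Formula S 0

record Structure (S : Set) : Set₁ where
  field
    Carrier : Set
    act     : S → Carrier → Carrier
open Structure public

extend : {A : Set} {n : ℕ} → A → (Fin n → A) → Fin (suc n) → A
extend a ρ Fin.zero    = a
extend a ρ (Fin.suc i) = ρ i

evalT : {S : Set} (A : Structure S) {n : ℕ} → (Fin n → Carrier A) → Term S n → Carrier A
evalT A ρ (var i)   = ρ i
evalT A ρ (app s t) = act A s (evalT A ρ t)

Sat : {S : Set} (A : Structure S) {n : ℕ} → (Fin n → Carrier A) → Formula S n → Set
Sat A ρ (t ≐ u)   = evalT A ρ t ≡ evalT A ρ u
Sat A ρ ⊥'        = ⊥
Sat A ρ (¬' φ)    = Sat A ρ φ → ⊥
Sat A ρ (φ ∧' ψ)  = Sat A ρ φ × Sat A ρ ψ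
Sat A ρ (φ ∨' ψ)  = Sat A ρ φ ⊎ Sat A ρ ψ
Sat A ρ (φ ⇒' ψ)  = Sat A ρ φ → Sat A ρ ψ
Sat A ρ (∀' φ)    = (a : Carrier A) → Sat A (extend a ρ) φ
Sat A ρ (∃' φ)    = Σ (Carrier A) (λ a → Sat A (extend a ρ) φ)

noVars : {A : Set} → Fin 0 → A
noVars ()

_⊨_ : {S : Set} → Structure S → Sentence S → Set
A ⊨ φ = Sat A noVars φ

Models : {S : Set} → Structure S → (Sentence S → Set) → Set
Models {S} A T = (φ : Sentence S) → T φ → A ⊨ φ

Axiomatizable : {S : Set} → (Structure S → Set) → Set₁
Axiomatizable {S} K =
  Σ (Sentence S → Set) λ T →
    (A : Structure S) → (Models A T → K A) × (K A → Models A T)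

IsPolygon : {S : Set} (_*_ : S → S → S) (e : S) → Structure S → Set
IsPolygon {S} _*_ e A =
  ((s₁ s₂ : S) (a : Carrier A) → act A s₁ (act A s₂ a) ≡ act A (s₁ * s₂) a)
  × ((a : Carrier A) → act A e a ≡ a)

Orbit : {S : Set} (A : Structure S) → Carrier A → Set
Orbit {S} A a = Σ (Carrier A) λ b → Σ S λ s → act A s a ≡ b

-- polygon homomorphisms Sa → S (S acting on itself by left multiplication);
-- the map must be well defined on elements of Sa (not depend on the witness s)
record OrbitHom {S : Set} (_*_ : S → S → S) (A : Structure S) (a : Carrier A) : Set where
  field
    fun         : Orbit A a → S
    wellDefined : (x y : Orbit A a) → proj₁ x ≡ proj₁ y → fun x ≡ fun y
    equivariant : (t : S) (x y : Orbit A a) →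
                  proj₁ y ≡ act A t (proj₁ x) → fun y ≡ t * fun x
open OrbitHom public

ActRegular : {S : Set} (_*_ : S → S → S) (A : Structure S) → Carrier A → Set
ActRegular _*_ A a =
  Σ (OrbitHom _*_ A a) λ φ →
    Σ (Orbit A a) λ x → (proj₁ x ≡ a) × (act A (fun φ x) a ≡ a)

RegularPolygon : {S : Set} (_*_ : S → S → S) (e : S) → Structure S → Set
RegularPolygon _*_ e A =
  IsPolygon _*_ e A × ((a : Carrier A) → ActRegular _*_ A a)

module Submission where

open import Defs
open import Level using (0ℓ)
open import Relation.Binary.PropositionalEquality using (_≡_)
open import Relation.Binary.PropositionalEquality using (refl; sym; trans; cong; module ≡-Reasoning)
open import Algebra.Structures using (IsGroup)
open import Axiom.ExcludedMiddle using (ExcludedMiddle)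
open import Algebra.Bundles using (Group)
import Algebra.Properties.Group as GroupProperties
open import Data.Product using (_,_; proj₁; proj₂)
open import Data.Empty using (⊥-elim)
open import Data.Fin using (Fin)
open import Relation.Nullary using (¬_; yes; no)

-- Over a group, an S-polygon is regular iff the action is free (only e has
-- a fixed point). Regularity at a yields u = φ(a) with u = s u whenever
-- s a = a, forcing s = e; conversely, freeness makes s ↦ s a injective, so
-- s a ↦ s is a well-defined homomorphism Sa → S sending a to e. Freeness is
-- axiomatized by the sentences ∀x. ¬ (s x = x), one for each s ≠ e.

module _ {S : Set} {_*_ : S → S → S} {e : S} {A : Structure S}
         (polygon : IsPolygon _*_ e A) where

  private
    compose : ∀ s₁ s₂ a → act A s₁ (act A s₂ a) ≡ act A (s₁ * s₂) a
    compose = proj₁ polygon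

    identity : ∀ a → act A e a ≡ a
    identity = proj₂ polygon

  orbit-injective⇒actRegular : (a : Carrier A) →
    (∀ s t → act A s a ≡ act A t a → s ≡ t) → ActRegular _*_ A a
  orbit-injective⇒actRegular a injective = φ , (a , e , identity a) , refl , identity a
    where
    φ : OrbitHom _*_ A a
    fun φ (_ , s , _) = s
    wellDefined φ (_ , s , sa≡b) (_ , s′ , s′a≡b′) b≡b′ =
      injective s s′ (trans sa≡b (trans b≡b′ (sym s′a≡b′)))
    equivariant φ t (_ , s , sa≡b) (_ , s′ , s′a≡b′) b′≡tb =
      injective s′ (t * s) (trans s′a≡b′ (trans b′≡tb
        (trans (cong (act A t) (sym sa≡b)) (compose t s a))))

module _ {S : Set} {_*_ : S → S → S} {e : S} {_⁻¹ : S → S}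
         (isGroup : IsGroup _≡_ _*_ e _⁻¹) where

  private
    group : Group 0ℓ 0ℓ
    group = record
      { Carrier = S ; _≈_ = _≡_ ; _∙_ = _*_ ; ε = e ; _⁻¹ = _⁻¹ ; isGroup = isGroup }
    open IsGroup isGroup using (inverseˡ)
    open GroupProperties group using (identityˡ-unique; x∙y⁻¹≈ε⇒x≈y)
    open ≡-Reasoning

  FreeAction : Structure S → Set
  FreeAction A = ∀ s a → act A s a ≡ a → s ≡ e

  module _ {A : Structure S} (polygon : IsPolygon _*_ e A) where

    private
      compose : ∀ s₁ s₂ a → act A s₁ (act A s₂ a) ≡ act A (s₁ * s₂) a
      compose = proj₁ polygon

      identity : ∀ a → act A e a ≡ a
      identity = proj₂ polygon

    act-inverseˡ : ∀ t a → act A (t ⁻¹) (act A t a) ≡ a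
    act-inverseˡ t a = begin
      act A (t ⁻¹) (act A t a)  ≡⟨ compose (t ⁻¹) t a ⟩
      act A ((t ⁻¹) * t) a      ≡⟨ cong (λ u → act A u a) (inverseˡ t) ⟩
      act A e a                 ≡⟨ identity a ⟩
      a                         ∎

    free⇒orbit-injective : FreeAction A →
      ∀ a s t → act A s a ≡ act A t a → s ≡ t
    free⇒orbit-injective free a s t sa≡ta =
      x∙y⁻¹≈ε⇒x≈y s t (free (s * (t ⁻¹)) (act A t a) fixes-ta)
      where
      fixes-ta : act A (s * (t ⁻¹)) (act A t a) ≡ act A t a
      fixes-ta = begin
        act A (s * (t ⁻¹)) (act A t a)      ≡⟨ compose s (t ⁻¹) (act A t a) ⟨
        act A s (act A (t ⁻¹) (act A t a))  ≡⟨ cong (act A s) (act-inverseˡ t a) ⟩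
        act A s a                           ≡⟨ sa≡ta ⟩
        act A t a                           ∎

    free⇒regular : FreeAction A → ∀ a → ActRegular _*_ A a
    free⇒regular free a = orbit-injective⇒actRegular polygon a (free⇒orbit-injective free a)

  regular⇒free : (A : Structure S) → (∀ a → ActRegular _*_ A a) → FreeAction A
  regular⇒free A regular s a sa≡a with regular a
  ... | φ , x , x≡a , _ = identityˡ-unique s (fun φ x) (sym φx≡sφx)
    where
    φx≡sφx : fun φ x ≡ s * fun φ x
    φx≡sφx = equivariant φ s x x (trans x≡a (sym (trans (cong (act A s) x≡a) sa≡a)))

  private
    x₀ : Term S 1
    x₀ = var Fin.zero

  data RegularPolygonAxiom : Sentence S → Set where
    compose-axiom  : ∀ s₁ s₂ → RegularPolygonAxiom (∀' (app s₁ (app s₂ x₀) ≐ app (s₁ * s₂) x₀))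
    identity-axiom : RegularPolygonAxiom (∀' (app e x₀ ≐ x₀))
    free-axiom     : ∀ s → ¬ s ≡ e → RegularPolygonAxiom (∀' ((app s x₀ ≐ x₀) ⇒' ⊥'))

  regular⇒models : (A : Structure S) → RegularPolygon _*_ e A → Models A RegularPolygonAxiom
  regular⇒models A ((compose , _) , _) _ (compose-axiom s₁ s₂) = compose s₁ s₂
  regular⇒models A ((_ , identity) , _) _ identity-axiom = identity
  regular⇒models A (_ , regular) _ (free-axiom s s≢e) a sa≡a =
    s≢e (regular⇒free A regular s a sa≡a)

  -- excluded middle is needed because the free axioms only speak about s ≢ e
  models⇒regular : ExcludedMiddle 0ℓ →
    (A : Structure S) → Models A RegularPolygonAxiom → RegularPolygon _*_ e A
  models⇒regular em A models = polygon , free⇒regular polygon free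
    where
    polygon : IsPolygon _*_ e A
    polygon = (λ s₁ s₂ → models _ (compose-axiom s₁ s₂)) , models _ identity-axiom
    free : FreeAction A
    free s a sa≡a with em {s ≡ e}
    ... | yes s≡e = s≡e
    ... | no s≢e = ⊥-elim (models _ (free-axiom s s≢e) a sa≡a)

corollary4p3 : ExcludedMiddle 0ℓ →
    (S : Set) (_*_ : S → S → S) (e : S) (_⁻¹ : S → S) →
    IsGroup _≡_ _*_ e _⁻¹ →
    Axiomatizable (RegularPolygon _*_ e)
corollary4p3 em S _*_ e _⁻¹ isGroup =
  RegularPolygonAxiom isGroup , λ A → models⇒regular isGroup em A , regular⇒models isGroup A
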